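{- Let $r$ be a power of $2$. For each odd integer $n>0$ let $A_n\in t\,\mathbb{Z}/2[t^2]$, and suppose that for all odd $n>0$ \[ A_{n+8r}=t^{8r}A_n+t^{2r}A_{n+2r}. \] If for every odd $n<8r^2$, $A_n$ equals $t^n$ plus a sum of monomials preceding $t^n$, then this holds for every odd $n>0$.
   Context: $\mathbb{N}=\{0,1,2,\dots\}$. Let $g:\mathbb{N}\to\mathbb{N}$ be defined by $g(0)=0$, $g(2n)=4g(n)$, $g(2n+1)=g(2n)+1$. For $a,b\in\mathbb{N}$, $[a,b]$ denotes the monomial $t^{1+2g(a)+4g(b)}\in\mathbb{Z}/2[t]$; $(a,b)\mapsto[a,b]$ is a bijection from $\mathbb{N}\times\mathbb{N}$ onto the monomials $t^k$, $k$ odd and positive. Say $[c,d]$ precedes (is earlier than) $[a,b]$ if $c+d<a+b$, or $c+d=a+b$ and $d<b$. "A sum of monomials" with some property means a finite sum (possibly empty) of distinct monomials with that property. -}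

module Defs where

open import Data.Nat using (ℕ; zero; suc; _+_; _*_; _∸_; _^_; _≤_; _<_; _≤ᵇ_; _/_; _%_)
open import Data.Bool using (Bool; true; false; if_then_else_; _xor_)
open import Data.Product using (Σ; ∃; _×_; _,_)
open import Data.Sum using (_⊎_)
open import Relation.Binary.PropositionalEquality using (_≡_; _≢_)

-- g(0)=0, g(2n)=4g(n), g(2n+1)=4g(n)+1, computed with fuel (fuel n suffices
-- for argument n since n/2 < n for n>0).
gF : ℕ → ℕ → ℕ
gF zero    n = 0
gF (suc f) n = 4 * gF f (n / 2) + n % 2

g : ℕ → ℕ
g n = gF n n

bracket : ℕ → ℕ → ℕ
bracket a b = 1 + 2 * g a + 4 * g b

Precedes : ℕ → ℕ → Set
Precedes m n = Σ ℕ λ a → Σ ℕ λ b → Σ ℕ λ c → Σ ℕ λ d →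
  (m ≡ bracket c d) × (n ≡ bracket a b) ×
  ((c + d < a + b) ⊎ ((c + d ≡ a + b) × (d < b)))

-- Polynomials over Z/2 in t, as coefficient functions (coefficient of t^m).
Coeffs : Set
Coeffs = ℕ → Bool

IsPoly : Coeffs → Set
IsPoly p = Σ ℕ λ N → ∀ m → N ≤ m → p m ≡ false

InTZ2T2 : Coeffs → Set
InTZ2T2 p = IsPoly p × (∀ m → m % 2 ≡ 0 → p m ≡ false)

_⊕_ : Coeffs → Coeffs → Coeffs
(p ⊕ q) m = p m xor q m

tpow_·_ : ℕ → Coeffs → Coeffs
(tpow k · p) m = if k ≤ᵇ m then p (m ∸ k) else false

_≈_ : Coeffs → Coeffs → Set
p ≈ q = ∀ m → p m ≡ q m

LeadForm : ℕ → Coeffs → Set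
LeadForm n p = (p n ≡ true) × (∀ m → m ≢ n → p m ≡ true → Precedes m n)

Odd : ℕ → Set
Odd n = n % 2 ≡ 1

-- Write an odd exponent as [a,b] = 1 + 2 (g a + 2 g b): the number g a + 2 g b interleaves
-- the binary digits of a (even positions) and b (odd positions), and "[c,d] precedes [a,b]"
-- compares the keys (c + d , d) and (a + b , b) lexicographically. Multiplying by t^(2R),
-- R = 2^e, adds R to the interleaving, that is 2^⌊e/2⌋ to a (e even) or to b (e odd); carries
-- never push the key beyond that of the carry-free sum, and below 4R adding 4R causes no carry.
-- Hence for n < 8R the recurrence A_{n+8R} = t^(8R) A_n + t^(2R) A_{n+2R} turns the leading
-- forms of A_n and A_{n+2R} into one of A_{n+8R}, extending leading forms from n < 8R to
-- n < 16R. Squaring the recurrence over Z/2 gives the same recurrence for 2R, and induction on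
-- R covers all n.

module Submission where

open import Defs
open import Data.Bool.Base using (Bool; true; false; T; _xor_)
open import Data.Bool.Properties using (xor-assoc; xor-same)
open import Data.Empty using (⊥-elim)
open import Data.Nat.Base
  using (ℕ; zero; suc; _+_; _*_; _∸_; _^_; _≤_; _<_; _≤ᵇ_; _/_; _%_; z≤n; s≤s; z<s)
open import Data.Nat.DivMod using (m/n<m; m*n/n≡m; m*n%n≡0; [m+kn]%n≡m%n; +-distrib-/)
open import Data.Nat.Induction using (<-rec)
open import Data.Nat.Properties
open import Data.Nat.Tactic.RingSolver using (solve-∀)
open import Data.Product.Base using (Σ; _×_; _,_; proj₁; proj₂)
open import Data.Product.Relation.Binary.Lex.Strict using (×-Lex)
open import Data.Sum.Base using (_⊎_; inj₁; inj₂)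
open import Relation.Binary.PropositionalEquality
open import Relation.Nullary using (¬_; yes; no)

-- Binary digits

bit : Bool → ℕ
bit false = 0
bit true  = 1

data DigitView : ℕ → Set where
  digits : (b : Bool) (q : ℕ) → DigitView (bit b + 2 * q)

digitView : ∀ n → DigitView n
digitView zero = digits false 0
digitView (suc n) with digitView n
... | digits false q = digits true q
... | digits true  q = subst DigitView (*-suc 2 q) (digits false (suc q))

digits-/2 : ∀ b q → (bit b + 2 * q) / 2 ≡ q
digits-/2 false q = trans (cong (_/ 2) (*-comm 2 q)) (m*n/n≡m q 2)
digits-/2 true  q = begin
  (1 + 2 * q) / 2 ≡⟨ cong (λ x → (1 + x) / 2) (*-comm 2 q) ⟩
  (1 + q * 2) / 2 ≡⟨ +-distrib-/ 1 (q * 2) (subst (λ r → 1 + r < 2) (sym (m*n%n≡0 q 2)) ≤-refl) ⟩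
  0 + q * 2 / 2   ≡⟨ m*n/n≡m q 2 ⟩
  q               ∎
  where open ≡-Reasoning

digits-%2 : ∀ b q → (bit b + 2 * q) % 2 ≡ bit b
digits-%2 b q = trans (cong (λ x → (bit b + x) % 2) (*-comm 2 q)) (trans ([m+kn]%n≡m%n (bit b) q 2) (bit-%2 b))
  where
  bit-%2 : ∀ b → bit b % 2 ≡ bit b
  bit-%2 false = refl
  bit-%2 true  = refl

digits-injective : ∀ a b {q r} → bit a + 2 * q ≡ bit b + 2 * r → a ≡ b × q ≡ r
digits-injective a b {q} {r} eq = bit-injective a b bits-eq , *-cancelˡ-≡ q r 2 halves-eq
  where
  bits-eq : bit a ≡ bit b
  bits-eq = trans (sym (digits-%2 a q)) (trans (cong (_% 2) eq) (digits-%2 b r))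
  halves-eq : 2 * q ≡ 2 * r
  halves-eq = +-cancelˡ-≡ (bit a) _ _ (trans eq (cong (_+ 2 * r) (sym bits-eq)))
  bit-injective : ∀ a b → bit a ≡ bit b → a ≡ b
  bit-injective false false _ = refl
  bit-injective true  true  _ = refl

+-right-comm : ∀ x y z → x + y + z ≡ x + z + y
+-right-comm = solve-∀

4*2*≡2*4* : ∀ x → 4 * (2 * x) ≡ 2 * (4 * x)
4*2*≡2*4* = solve-∀

8*≡2*4* : ∀ x → 8 * x ≡ 2 * (4 * x)
8*≡2*4* = solve-∀

2*m≤1+n⇒m≤n : ∀ {s f} → 2 * s ≤ suc f → s ≤ f
2*m≤1+n⇒m≤n {zero}  _  = z≤n
2*m≤1+n⇒m≤n {suc s} le = ≤-pred (<-≤-trans (m<m+n (suc s) z<s)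
  (≤-trans (≤-reflexive (cong (suc s +_) (sym (+-identityʳ (suc s))))) le))

digit-induction₂ : (P : ℕ → ℕ → Set) → P 0 0 →
  (∀ a b {c d} → P c d → P (bit a + 2 * c) (bit b + 2 * d)) → ∀ c d → P c d
digit-induction₂ P base step c d = bounded (c + d) c d ≤-refl
  where
  bounded : ∀ n c d → c + d ≤ n → P c d
  bounded zero c d le = subst₂ P (sym (m+n≡0⇒m≡0 c sum≡0)) (sym (m+n≡0⇒n≡0 c sum≡0)) base
    where sum≡0 = n≤0⇒n≡0 le
  bounded (suc n) c d le with digitView c | digitView d
  ... | digits a c₁ | digits b d₁ = step a b (bounded n c₁ d₁ (2*m≤1+n⇒m≤n halves≤))
    where
    halves≤ : 2 * (c₁ + d₁) ≤ suc n
    halves≤ = ≤-trans (≤-reflexive (*-distribˡ-+ 2 c₁ d₁))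
                (≤-trans (+-mono-≤ (m≤n+m _ (bit a)) (m≤n+m _ (bit b))) le)

digit-induction : (P : ℕ → Set) → P 0 → (∀ b {q} → P q → P (bit b + 2 * q)) → ∀ n → P n
digit-induction P base step n = digit-induction₂ (λ c _ → P c) base (λ a _ → step a) n 0

digits<2*⇒< : ∀ b {q m} → bit b + 2 * q < 2 * m → q < m
digits<2*⇒< b {q} lt = *-cancelˡ-< 2 q _ (≤-<-trans (m≤n+m (2 * q) (bit b)) lt)

<⇒digits<2* : ∀ b {q m} → q < m → bit b + 2 * q < 2 * m
<⇒digits<2* b {q} lt =
  ≤-trans (s≤s (+-monoˡ-≤ (2 * q) (bit≤1 b))) (≤-trans (≤-reflexive (sym (*-suc 2 q))) (*-monoʳ-≤ 2 lt))
  where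
  bit≤1 : ∀ b → bit b ≤ 1
  bit≤1 false = z≤n
  bit≤1 true  = s≤s z≤n

m≤1+n⇒m/2≤n : ∀ {m n} → m ≤ suc n → m / 2 ≤ n
m≤1+n⇒m/2≤n {zero}  _  = z≤n
m≤1+n⇒m/2≤n {suc m} le = ≤-pred (<-≤-trans (m/n<m (suc m) 2 (s≤s (s≤s z≤n))) le)

-- The digit-spreading map g and the interleaving

gF-zero : ∀ f → gF f 0 ≡ 0
gF-zero zero    = refl
gF-zero (suc f) = cong (λ x → 4 * x + 0) (gF-zero f)

gF-fuel-irrelevant : ∀ f f′ {n} → n ≤ f → n ≤ f′ → gF f n ≡ gF f′ n
gF-fuel-irrelevant zero    zero     _  _   = refl
gF-fuel-irrelevant zero    (suc f′) z≤n _  = sym (gF-zero (suc f′))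
gF-fuel-irrelevant (suc f) zero     _  z≤n = gF-zero (suc f)
gF-fuel-irrelevant (suc f) (suc f′) {n} le le′ =
  cong (λ x → 4 * x + n % 2) (gF-fuel-irrelevant f f′ (m≤1+n⇒m/2≤n le) (m≤1+n⇒m/2≤n le′))

g-unfold : ∀ n → g n ≡ 4 * g (n / 2) + n % 2
g-unfold zero    = refl
g-unfold (suc n) = cong (λ x → 4 * x + suc n % 2)
  (gF-fuel-irrelevant n (suc n / 2) (m≤1+n⇒m/2≤n ≤-refl) ≤-refl)

g-digits : ∀ b q → g (bit b + 2 * q) ≡ bit b + 4 * g q
g-digits b q = begin
  g (bit b + 2 * q)                                   ≡⟨ g-unfold (bit b + 2 * q) ⟩
  4 * g ((bit b + 2 * q) / 2) + (bit b + 2 * q) % 2   ≡⟨ cong₂ (λ x y → 4 * g x + y) (digits-/2 b q) (digits-%2 b q) ⟩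
  4 * g q + bit b                                     ≡⟨ +-comm (4 * g q) (bit b) ⟩
  bit b + 4 * g q                                     ∎
  where open ≡-Reasoning

n≤g : ∀ n → n ≤ g n
n≤g = digit-induction (λ n → n ≤ g n) z≤n step
  where
  2≤4 : 2 ≤ 4
  2≤4 = s≤s (s≤s z≤n)
  step : ∀ b {q} → q ≤ g q → bit b + 2 * q ≤ g (bit b + 2 * q)
  step b {q} ih = subst (bit b + 2 * q ≤_) (sym (g-digits b q))
    (+-monoʳ-≤ (bit b) (*-mono-≤ 2≤4 ih))

g<4^⇒<2^ : ∀ k {a} → g a < 4 ^ k → a < 2 ^ k
g<4^⇒<2^ zero    {a} lt = ≤-<-trans (n≤g a) lt
g<4^⇒<2^ (suc k) {a} lt with digitView a
... | digits b q = <⇒digits<2* b (g<4^⇒<2^ k {q} (*-cancelˡ-< 4 (g q) _ 4gq<))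
  where
  4gq< : 4 * g q < 4 * 4 ^ k
  4gq< = ≤-<-trans (m≤n+m _ (bit b)) (subst (_< 4 ^ suc k) (g-digits b q) lt)

g-+2^ : ∀ k {a} → a < 2 ^ k → g (a + 2 ^ k) ≡ g a + 4 ^ k
g-+2^ zero    {zero}  _           = refl
g-+2^ zero    {suc a} (s≤s ())
g-+2^ (suc k) {a} lt with digitView a
... | digits b q = begin
  g (bit b + 2 * q + 2 ^ suc k)      ≡⟨ cong g (distrib 2 (bit b) q (2 ^ k)) ⟩
  g (bit b + 2 * (q + 2 ^ k))        ≡⟨ g-digits b (q + 2 ^ k) ⟩
  bit b + 4 * g (q + 2 ^ k)          ≡⟨ cong (λ x → bit b + 4 * x) (g-+2^ k {q} (digits<2*⇒< b lt)) ⟩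
  bit b + 4 * (g q + 4 ^ k)          ≡⟨ sym (distrib 4 (bit b) (g q) (4 ^ k)) ⟩
  bit b + 4 * g q + 4 ^ suc k        ≡⟨ cong (_+ 4 ^ suc k) (sym (g-digits b q)) ⟩
  g (bit b + 2 * q) + 4 ^ suc k      ∎
  where
  open ≡-Reasoning
  distrib : ∀ m x y z → x + m * y + m * z ≡ x + m * (y + z)
  distrib = solve-∀

interleave : ℕ → ℕ → ℕ
interleave c d = g c + 2 * g d

interleave-digits : ∀ a b c d →
  interleave (bit a + 2 * c) (bit b + 2 * d) ≡ bit a + 2 * (bit b + 2 * interleave c d)
interleave-digits a b c d rewrite g-digits a c | g-digits b d = regroup (bit a) (bit b) (g c) (g d)
  where
  regroup : ∀ x y u v → x + 4 * u + 2 * (y + 4 * v) ≡ x + 2 * (y + 2 * (u + 2 * v))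
  regroup = solve-∀

g≡0⇒≡0 : ∀ {c} → g c ≡ 0 → c ≡ 0
g≡0⇒≡0 {c} eq = n≤0⇒n≡0 (subst (c ≤_) eq (n≤g c))

interleave-injective : ∀ {c d c′ d′} → interleave c d ≡ interleave c′ d′ → c ≡ c′ × d ≡ d′
interleave-injective {c} {d} {c′} {d′} = digit-induction₂ Determines base step c d c′ d′
  where
  Determines : ℕ → ℕ → Set
  Determines c d = ∀ c′ d′ → interleave c d ≡ interleave c′ d′ → c ≡ c′ × d ≡ d′
  base : Determines 0 0
  base c′ d′ eq = sym (g≡0⇒≡0 (m+n≡0⇒m≡0 (g c′) (sym eq))) ,
                  sym (g≡0⇒≡0 (m+n≡0⇒m≡0 (g d′) (m+n≡0⇒n≡0 (g c′) (sym eq))))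
  step : ∀ a b {c d} → Determines c d → Determines (bit a + 2 * c) (bit b + 2 * d)
  step a b {c} {d} ih c′ d′ eq with digitView c′ | digitView d′
  ... | digits a′ c₁ | digits b′ d₁
    with digits-injective a a′ (trans (sym (interleave-digits a b c d)) (trans eq (interleave-digits a′ b′ c₁ d₁)))
  ... | refl , eq₁ with digits-injective b b′ eq₁
  ... | refl , eq₂ with ih c₁ d₁ eq₂
  ... | refl , refl = refl , refl

-- Lexicographic keys

infix 4 _<ₗ_ _≤ₗ_
infixl 6 _⊞_

_<ₗ_ : ℕ × ℕ → ℕ × ℕ → Set
_<ₗ_ = ×-Lex _≡_ _<_ _<_

_≤ₗ_ : ℕ × ℕ → ℕ × ℕ → Set
_≤ₗ_ = ×-Lex _≡_ _<_ _≤_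

_⊞_ : ℕ × ℕ → ℕ × ℕ → ℕ × ℕ
(s , e) ⊞ (s′ , e′) = s + s′ , e + e′

double : ℕ × ℕ → ℕ × ℕ
double (s , e) = 2 * s , 2 * e

≤ₗ-reflexive : ∀ {p q} → p ≡ q → p ≤ₗ q
≤ₗ-reflexive refl = inj₂ (refl , ≤-refl)

≤ₗ⇒proj₁≤ : ∀ {p q} → p ≤ₗ q → proj₁ p ≤ proj₁ q
≤ₗ⇒proj₁≤ (inj₁ lt)         = <⇒≤ lt
≤ₗ⇒proj₁≤ (inj₂ (refl , _)) = ≤-refl

<ₗ-irrefl : ∀ {p} → ¬ (p <ₗ p)
<ₗ-irrefl (inj₁ lt)       = <-irrefl refl lt
<ₗ-irrefl (inj₂ (_ , lt)) = <-irrefl refl lt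

≤ₗ-trans : ∀ {p q r} → p ≤ₗ q → q ≤ₗ r → p ≤ₗ r
≤ₗ-trans (inj₁ lt)          (inj₁ lt′)          = inj₁ (<-trans lt lt′)
≤ₗ-trans (inj₁ lt)          (inj₂ (refl , _))   = inj₁ lt
≤ₗ-trans (inj₂ (refl , _))  (inj₁ lt′)          = inj₁ lt′
≤ₗ-trans (inj₂ (refl , le)) (inj₂ (refl , le′)) = inj₂ (refl , ≤-trans le le′)

≤ₗ-<ₗ-trans : ∀ {p q r} → p ≤ₗ q → q <ₗ r → p <ₗ r
≤ₗ-<ₗ-trans (inj₁ lt)          (inj₁ lt′)          = inj₁ (<-trans lt lt′)
≤ₗ-<ₗ-trans (inj₁ lt)          (inj₂ (refl , _))   = inj₁ lt
≤ₗ-<ₗ-trans (inj₂ (refl , _))  (inj₁ lt′)          = inj₁ lt′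
≤ₗ-<ₗ-trans (inj₂ (refl , le)) (inj₂ (refl , lt′)) = inj₂ (refl , ≤-<-trans le lt′)

<ₗ-≤ₗ-trans : ∀ {p q r} → p <ₗ q → q ≤ₗ r → p <ₗ r
<ₗ-≤ₗ-trans (inj₁ lt)          (inj₁ lt′)          = inj₁ (<-trans lt lt′)
<ₗ-≤ₗ-trans (inj₁ lt)          (inj₂ (refl , _))   = inj₁ lt
<ₗ-≤ₗ-trans (inj₂ (refl , _))  (inj₁ lt′)          = inj₁ lt′
<ₗ-≤ₗ-trans (inj₂ (refl , lt)) (inj₂ (refl , le′)) = inj₂ (refl , <-≤-trans lt le′)

⊞-monoˡ-≤ₗ : ∀ {p q} r → p ≤ₗ q → p ⊞ r ≤ₗ q ⊞ r
⊞-monoˡ-≤ₗ (s , e) (inj₁ lt)          = inj₁ (+-monoˡ-< s lt)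
⊞-monoˡ-≤ₗ (s , e) (inj₂ (refl , le)) = inj₂ (refl , +-monoˡ-≤ e le)

⊞-monoˡ-<ₗ : ∀ {p q} r → p <ₗ q → p ⊞ r <ₗ q ⊞ r
⊞-monoˡ-<ₗ (s , e) (inj₁ lt)          = inj₁ (+-monoˡ-< s lt)
⊞-monoˡ-<ₗ (s , e) (inj₂ (refl , lt)) = inj₂ (refl , +-monoˡ-< e lt)

⊞-monoʳ-≤ₗ : ∀ p {q r} → q ≤ₗ r → p ⊞ q ≤ₗ p ⊞ r
⊞-monoʳ-≤ₗ (s , e) (inj₁ lt)          = inj₁ (+-monoʳ-< s lt)
⊞-monoʳ-≤ₗ (s , e) (inj₂ (refl , le)) = inj₂ (refl , +-monoʳ-≤ e le)

⊞-monoʳ-<ₗ : ∀ p {q r} → q <ₗ r → p ⊞ q <ₗ p ⊞ r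
⊞-monoʳ-<ₗ (s , e) (inj₁ lt)          = inj₁ (+-monoʳ-< s lt)
⊞-monoʳ-<ₗ (s , e) (inj₂ (refl , lt)) = inj₂ (refl , +-monoʳ-< e lt)

double-mono-≤ₗ : ∀ {p q} → p ≤ₗ q → double p ≤ₗ double q
double-mono-≤ₗ (inj₁ lt)          = inj₁ (*-monoʳ-< 2 lt)
double-mono-≤ₗ (inj₂ (refl , le)) = inj₂ (refl , *-monoʳ-≤ 2 le)

⊞-assoc : ∀ p q r → (p ⊞ q) ⊞ r ≡ p ⊞ (q ⊞ r)
⊞-assoc (s , e) (s′ , e′) (s′′ , e′′) = cong₂ _,_ (+-assoc s s′ s′′) (+-assoc e e′ e′′)

⊞-double : ∀ p q → (p ⊞ q) ⊞ q ≡ p ⊞ double q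
⊞-double (s , e) (s′ , e′) = cong₂ _,_ (twice s s′) (twice e e′)
  where
  twice : ∀ x y → x + y + y ≡ x + 2 * y
  twice = solve-∀

double-⊞ : ∀ p q → double (p ⊞ q) ≡ double p ⊞ double q
double-⊞ (s , e) (s′ , e′) = cong₂ _,_ (*-distribˡ-+ 2 s s′) (*-distribˡ-+ 2 e e′)

-- Precedes m n says that m = [c,d], n = [a,b] and key c d <ₗ key a b.
key : ℕ → ℕ → ℕ × ℕ
key c d = c + d , d

key-digits : ∀ a b c d → key (bit a + 2 * c) (bit b + 2 * d) ≡ key (bit a) (bit b) ⊞ double (key c d)
key-digits a b c d = cong₂ _,_ (regroup (bit a) (bit b) c d) refl
  where
  regroup : ∀ x y u v → x + 2 * u + (y + 2 * v) ≡ x + y + 2 * (u + v)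
  regroup = solve-∀

-- Carries

record Raise (δ : ℕ) (v : ℕ × ℕ) (c d : ℕ) : Set where
  constructor raised
  field
    c′ d′ : ℕ
    interleave-≡ : interleave c′ d′ ≡ interleave c d + δ
    key-≤ₗ       : key c′ d′ ≤ₗ key c d ⊞ v

raise-transfer : ∀ {δ₀ v₀ c₀ d₀ δ v c d} →
  interleave c₀ d₀ + δ₀ ≡ interleave c d + δ → key c₀ d₀ ⊞ v₀ ≤ₗ key c d ⊞ v →
  Raise δ₀ v₀ c₀ d₀ → Raise δ v c d
raise-transfer eq le (raised c′ d′ eq′ le′) = raised c′ d′ (trans eq′ eq) (≤ₗ-trans le′ le)

interleave-digits-+ : ∀ a b c d a′ b′ c′ d′ δ →
  bit a′ + 2 * (bit b′ + 2 * interleave c′ d′) ≡ bit a + 2 * (bit b + 2 * interleave c d) + δ →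
  interleave (bit a′ + 2 * c′) (bit b′ + 2 * d′) ≡ interleave (bit a + 2 * c) (bit b + 2 * d) + δ
interleave-digits-+ a b c d a′ b′ c′ d′ δ eq =
  trans (interleave-digits a′ b′ c′ d′) (trans eq (cong (_+ δ) (sym (interleave-digits a b c d))))

raise-digits : ∀ a b {δ v c d} → Raise δ v c d →
  Raise (4 * δ) (double v) (bit a + 2 * c) (bit b + 2 * d)
raise-digits a b {δ} {v} {c} {d} (raised c′ d′ eq le) =
  raised (bit a + 2 * c′) (bit b + 2 * d′)
    (interleave-digits-+ a b c d a b c′ d′ (4 * δ)
      (trans (cong (λ x → bit a + 2 * (bit b + 2 * x)) eq) (carry (bit a) (bit b) (interleave c d) δ)))
    key-le
  where
  carry : ∀ x y u w → x + 2 * (y + 2 * (u + w)) ≡ x + 2 * (y + 2 * u) + 4 * w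
  carry = solve-∀
  key-le : key (bit a + 2 * c′) (bit b + 2 * d′) ≤ₗ key (bit a + 2 * c) (bit b + 2 * d) ⊞ double v
  key-le = subst₂ _≤ₗ_ (sym (key-digits a b c′ d′)) regroup
             (⊞-monoʳ-≤ₗ (key (bit a) (bit b)) (double-mono-≤ₗ le))
    where
    regroup : key (bit a) (bit b) ⊞ double (key c d ⊞ v) ≡ key (bit a + 2 * c) (bit b + 2 * d) ⊞ double v
    regroup = begin
      key (bit a) (bit b) ⊞ double (key c d ⊞ v)                ≡⟨ cong (key (bit a) (bit b) ⊞_) (double-⊞ (key c d) v) ⟩
      key (bit a) (bit b) ⊞ (double (key c d) ⊞ double v)       ≡⟨ sym (⊞-assoc (key (bit a) (bit b)) _ _) ⟩
      key (bit a) (bit b) ⊞ double (key c d) ⊞ double v         ≡⟨ cong (_⊞ double v) (sym (key-digits a b c d)) ⟩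
      key (bit a + 2 * c) (bit b + 2 * d) ⊞ double v            ∎
      where open ≡-Reasoning

raise-1 : ∀ c d → Raise 1 (1 , 0) c d
raise-1 = digit-induction₂ (Raise 1 (1 , 0)) (raised 1 0 refl (≤ₗ-reflexive refl)) step
  where
  step : ∀ a b {c d} → Raise 1 (1 , 0) c d → Raise 1 (1 , 0) (bit a + 2 * c) (bit b + 2 * d)
  step false b {c} {d} _ =
    raised (1 + 2 * c) (bit b + 2 * d)
    (interleave-digits-+ false b c d true b c d 1 (set-bit (bit b) (interleave c d)))
    (≤ₗ-reflexive (cong₂ _,_ (+-comm 1 _) (sym (+-identityʳ _))))
    where
    set-bit : ∀ y p → 1 + 2 * (y + 2 * p) ≡ 2 * (y + 2 * p) + 1
    set-bit = solve-∀
  step true false {c} {d} _ =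
    raised (2 * c) (1 + 2 * d)
    (interleave-digits-+ true false c d false true c d 1 (carry (interleave c d)))
    (inj₁ (≤-reflexive (sum-eq c d)))
    where
    carry : ∀ p → 2 * (1 + 2 * p) ≡ 1 + 2 * (2 * p) + 1
    carry = solve-∀
    sum-eq : ∀ c d → suc (2 * c + (1 + 2 * d)) ≡ 1 + 2 * c + 2 * d + 1
    sum-eq = solve-∀
  step true true {c} {d} (raised x y eq le) =
    raised (2 * x) (2 * y)
    (interleave-digits-+ true true c d false false x y 1
      (trans (cong (λ p → 2 * (2 * p)) eq) (carry (interleave c d))))
    (inj₁ sum<)
    where
    carry : ∀ p → 2 * (2 * (p + 1)) ≡ 1 + 2 * (1 + 2 * p) + 1
    carry = solve-∀
    sum< : 2 * x + 2 * y < 1 + 2 * c + (1 + 2 * d) + 1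
    sum< = begin-strict
      2 * x + 2 * y              ≡⟨ sym (*-distribˡ-+ 2 x y) ⟩
      2 * (x + y)                ≤⟨ *-monoʳ-≤ 2 (≤ₗ⇒proj₁≤ le) ⟩
      2 * (c + d + 1)            <⟨ ≤-reflexive (regroup c d) ⟩
      1 + 2 * c + (1 + 2 * d) + 1 ∎
      where
      open ≤-Reasoning
      regroup : ∀ c d → suc (2 * (c + d + 1)) ≡ 1 + 2 * c + (1 + 2 * d) + 1
      regroup = solve-∀

raise-2 : ∀ c d → Raise 2 (1 , 1) c d
raise-2 c d with digitView c | digitView d
... | digits a c₁ | digits false d₁ =
  raised (bit a + 2 * c₁) (1 + 2 * d₁)
  (interleave-digits-+ a false c₁ d₁ a true c₁ d₁ 2 (set-bit (bit a) (interleave c₁ d₁)))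
  (≤ₗ-reflexive (cong₂ _,_ (regroup (bit a + 2 * c₁) d₁) (+-comm 1 _)))
  where
  set-bit : ∀ x p → x + 2 * (1 + 2 * p) ≡ x + 2 * (2 * p) + 2
  set-bit = solve-∀
  regroup : ∀ x d → x + (1 + 2 * d) ≡ x + 2 * d + 1
  regroup = solve-∀
... | digits a c₁ | digits true d₁ =
  raise-transfer
    (trans (cong (_+ 4) (interleave-digits a false c₁ d₁))
      (trans (carry (bit a) (interleave c₁ d₁)) (cong (_+ 2) (sym (interleave-digits a true c₁ d₁)))))
    (inj₂ (regroup (bit a + 2 * c₁) d₁ , ≤-trans (≤-reflexive (+-identityʳ (2 * d₁))) (≤-trans (m≤n+m (2 * d₁) 1) (m≤m+n _ 1))))
    (raise-digits a false (raise-1 c₁ d₁))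
  where
  carry : ∀ x p → x + 2 * (2 * p) + 4 ≡ x + 2 * (1 + 2 * p) + 2
  carry = solve-∀
  regroup : ∀ x d → x + 2 * d + 2 ≡ x + (1 + 2 * d) + 1
  regroup = solve-∀

raise-4^ : ∀ i c d → Raise (4 ^ i) (2 ^ i , 0) c d
raise-4^ zero    c d = raise-1 c d
raise-4^ (suc i) c d with digitView c | digitView d
... | digits a c₁ | digits b d₁ = raise-digits a b (raise-4^ i c₁ d₁)

raise-2*4^ : ∀ i c d → Raise (2 * 4 ^ i) (2 ^ i , 2 ^ i) c d
raise-2*4^ zero    c d = raise-2 c d
raise-2*4^ (suc i) c d with digitView c | digitView d
... | digits a c₁ | digits b d₁ =
  subst (λ δ → Raise δ (2 ^ suc i , 2 ^ suc i) (bit a + 2 * c₁) (bit b + 2 * d₁)) (4*2*≡2*4* (4 ^ i))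
    (raise-digits a b (raise-2*4^ i c₁ d₁))

interleave-surjective : ∀ h → Σ ℕ λ c → Σ ℕ λ d → interleave c d ≡ h
interleave-surjective zero    = 0 , 0 , refl
interleave-surjective (suc h) with interleave-surjective h
... | c , d , refl = Raise.c′ next , Raise.d′ next , trans (Raise.interleave-≡ next) (+-comm _ 1)
  where next = raise-1 c d

interleave-+2^ˡ : ∀ i a b → interleave a b < 4 ^ i → interleave (a + 2 ^ i) b ≡ interleave a b + 4 ^ i
interleave-+2^ˡ i a b lt = begin
  g (a + 2 ^ i) + 2 * g b    ≡⟨ cong (_+ 2 * g b) (g-+2^ i {a} (g<4^⇒<2^ i (≤-<-trans (m≤m+n (g a) _) lt))) ⟩
  g a + 4 ^ i + 2 * g b      ≡⟨ +-right-comm (g a) (4 ^ i) _ ⟩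
  g a + 2 * g b + 4 ^ i      ∎
  where open ≡-Reasoning

interleave-+2^ʳ : ∀ i a b → interleave a b < 2 * 4 ^ i → interleave a (b + 2 ^ i) ≡ interleave a b + 2 * 4 ^ i
interleave-+2^ʳ i a b lt = begin
  g a + 2 * g (b + 2 ^ i)    ≡⟨ cong (λ x → g a + 2 * x) (g-+2^ i {b} (g<4^⇒<2^ i gb<)) ⟩
  g a + 2 * (g b + 4 ^ i)    ≡⟨ distrib (g a) (g b) (4 ^ i) ⟩
  g a + 2 * g b + 2 * 4 ^ i  ∎
  where
  open ≡-Reasoning
  gb< : g b < 4 ^ i
  gb< = *-cancelˡ-< 2 (g b) _ (≤-<-trans (m≤n+m _ (g a)) lt)
  distrib : ∀ x y z → x + 2 * (y + z) ≡ x + 2 * y + 2 * z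
  distrib = solve-∀

record Stride (R : ℕ) : Set where
  field
    0<R            : 0 < R
    v u            : ℕ × ℕ
    u<ₗdouble-v    : u <ₗ double v
    raise-R        : ∀ c d → Raise R v c d
    raise-2R       : ∀ c d → Raise (2 * R) u c d
    raise-4R       : ∀ c d → Raise (4 * R) (double v) c d
    raise-4R-exact : ∀ a b → interleave a b < 4 * R → Σ ℕ λ a′ → Σ ℕ λ b′ →
      (interleave a′ b′ ≡ interleave a b + 4 * R) × (key a′ b′ ≡ key a b ⊞ double v)

n<2*n : ∀ {n} → 0 < n → n < 2 * n
n<2*n {n} pos = m<m+n n (subst (0 <_) (sym (+-identityʳ n)) pos)

stride-4^ : ∀ j → Stride (4 ^ j)
stride-4^ j = record
  { 0<R            = m^n>0 4 j
  ; v              = 2 ^ j , 0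
  ; u              = 2 ^ j , 2 ^ j
  ; u<ₗdouble-v    = inj₁ (n<2*n (m^n>0 2 j))
  ; raise-R        = raise-4^ j
  ; raise-2R       = raise-2*4^ j
  ; raise-4R       = raise-4^ (suc j)
  ; raise-4R-exact = λ a b lt → a + 2 ^ suc j , b , interleave-+2^ˡ (suc j) a b lt ,
                       cong₂ _,_ (+-right-comm a (2 ^ suc j) b) (sym (+-identityʳ b))
  }

stride-2*4^ : ∀ j → Stride (2 * 4 ^ j)
stride-2*4^ j = record
  { 0<R            = *-monoʳ-< 2 (m^n>0 4 j)
  ; v              = 2 ^ j , 2 ^ j
  ; u              = 2 ^ suc j , 0
  ; u<ₗdouble-v    = inj₂ (refl , m^n>0 2 (suc j))
  ; raise-R        = raise-2*4^ j
  ; raise-2R       = λ c d → subst (λ δ → Raise δ (2 ^ suc j , 0) c d) (4*≡2*2* (4 ^ j)) (raise-4^ (suc j) c d)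
  ; raise-4R       = λ c d → subst (λ δ → Raise δ (2 ^ suc j , 2 ^ suc j) c d) (sym (4*2*≡2*4* (4 ^ j))) (raise-2*4^ (suc j) c d)
  ; raise-4R-exact = λ a b lt → a , b + 2 ^ suc j ,
                       trans (interleave-+2^ʳ (suc j) a b (subst (interleave a b <_) (4*2*≡2*4* (4 ^ j)) lt))
                             (cong (interleave a b +_) (sym (4*2*≡2*4* (4 ^ j)))) ,
                       cong₂ _,_ (sym (+-assoc a b (2 ^ suc j))) refl
  }
  where
  4*≡2*2* : ∀ x → 4 * x ≡ 2 * (2 * x)
  4*≡2*2* = solve-∀

stride : ∀ e → Stride (2 ^ e)
stride e with digitView e
... | digits false j = subst Stride (^-*-assoc 2 2 j) (stride-4^ j)
... | digits true  j = subst Stride (cong (2 *_) (^-*-assoc 2 2 j)) (stride-2*4^ j)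

bracket-interleave : ∀ c d → bracket c d ≡ suc (2 * interleave c d)
bracket-interleave c d = regroup (g c) (g d)
  where
  regroup : ∀ x y → 1 + 2 * x + 4 * y ≡ suc (2 * (x + 2 * y))
  regroup = solve-∀

bracket-+ : ∀ c d c′ d′ {δ} → interleave c′ d′ ≡ interleave c d + δ → bracket c′ d′ ≡ bracket c d + 2 * δ
bracket-+ c d c′ d′ {δ} eq = begin
  bracket c′ d′                         ≡⟨ bracket-interleave c′ d′ ⟩
  suc (2 * interleave c′ d′)            ≡⟨ cong (λ x → suc (2 * x)) eq ⟩
  suc (2 * (interleave c d + δ))        ≡⟨ cong suc (*-distribˡ-+ 2 (interleave c d) δ) ⟩
  suc (2 * interleave c d) + 2 * δ      ≡⟨ cong (_+ 2 * δ) (sym (bracket-interleave c d)) ⟩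
  bracket c d + 2 * δ                   ∎
  where open ≡-Reasoning

raise-bracket : ∀ {δ v c d} (r : Raise δ v c d) → bracket (Raise.c′ r) (Raise.d′ r) ≡ bracket c d + 2 * δ
raise-bracket {c = c} {d} (raised c′ d′ eq _) = bracket-+ c d c′ d′ eq

bracket-injective : ∀ {c d c′ d′} → bracket c d ≡ bracket c′ d′ → c ≡ c′ × d ≡ d′
bracket-injective {c} {d} {c′} {d′} eq = interleave-injective (*-cancelˡ-≡ _ _ 2
  (suc-injective (trans (sym (bracket-interleave c d)) (trans eq (bracket-interleave c′ d′)))))

bracket<2*⇒interleave< : ∀ {a b N} → bracket a b < 2 * N → interleave a b < N
bracket<2*⇒interleave< {a} {b} {N} lt = digits<2*⇒< true (subst (_< 2 * N) (bracket-interleave a b) lt)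

odd⇒bracket : ∀ {n} → Odd n → Σ ℕ λ a → Σ ℕ λ b → n ≡ bracket a b
odd⇒bracket {n} odd with digitView n
... | digits false q = ⊥-elim (0≢1+n (trans (sym (digits-%2 false q)) odd))
... | digits true  q with interleave-surjective q
...   | a , b , refl = a , b , sym (bracket-interleave a b)

precedes-irrefl : ∀ {n} → ¬ Precedes n n
precedes-irrefl (a , b , c , d , n≡cd , n≡ab , lt) with bracket-injective {c} {d} {a} {b} (trans (sym n≡cd) n≡ab)
... | refl , refl = <ₗ-irrefl lt

module _ {R : ℕ} (S : Stride R) where
  open Stride S

  private
    bracket-+8* : ∀ c d c′ d′ → interleave c′ d′ ≡ interleave c d + 4 * R → bracket c d + 8 * R ≡ bracket c′ d′
    bracket-+8* c d c′ d′ eq = trans (cong (bracket c d +_) (8*≡2*4* R)) (sym (bracket-+ c d c′ d′ eq))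

    below-8* : ∀ {a b} → bracket a b < 8 * R → interleave a b < 4 * R
    below-8* {a} {b} lt = bracket<2*⇒interleave< {a} {b} (subst (bracket a b <_) (8*≡2*4* R) lt)

  precedes-+8* : ∀ {m n} → n < 8 * R → Precedes m n → Precedes (m + 8 * R) (n + 8 * R)
  precedes-+8* n< (a , b , c , d , refl , refl , lt) with raise-4R-exact a b (below-8* {a} {b} n<) | raise-4R c d
  ... | a′ , b′ , eqa , keya | raised x y eqx kx =
    a′ , b′ , x , y , bracket-+8* c d x y eqx , bracket-+8* a b a′ b′ eqa ,
    <ₗ-≤ₗ-trans (≤ₗ-<ₗ-trans kx (⊞-monoˡ-<ₗ (double v) lt)) (≤ₗ-reflexive (sym keya))

  precedes-+2* : ∀ {m n} → Odd n → n < 8 * R → m ≡ n + 2 * R ⊎ Precedes m (n + 2 * R) →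
    Precedes (m + 2 * R) (n + 8 * R)
  precedes-+2* {m} {n} odd n< h with odd⇒bracket {n} odd
  ... | a , b , refl with raise-4R-exact a b (below-8* {a} {b} n<) | raise-R a b
  ...   | a′ , b′ , eqa , keya | ry@(raised y₁ y₂ _ ky) = lower h
    where
    regroup : ∀ x y → x + 2 * y + 2 * y ≡ x + 2 * (2 * y)
    regroup = solve-∀
    conclude : ∀ {x₁ x₂} → m + 2 * R ≡ bracket x₁ x₂ → key x₁ x₂ <ₗ key a b ⊞ double v →
      Precedes (m + 2 * R) (bracket a b + 8 * R)
    conclude {x₁} {x₂} eq lt =
      a′ , b′ , x₁ , x₂ , eq , bracket-+8* a b a′ b′ eqa , <ₗ-≤ₗ-trans lt (≤ₗ-reflexive (sym keya))
    lower : m ≡ bracket a b + 2 * R ⊎ Precedes m (bracket a b + 2 * R) → Precedes (m + 2 * R) (bracket a b + 8 * R)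
    lower (inj₁ refl) with raise-2R a b
    ... | r@(raised x₁ x₂ _ kx) =
      conclude (trans (regroup (bracket a b) R) (sym (raise-bracket r)))
               (≤ₗ-<ₗ-trans kx (⊞-monoʳ-<ₗ (key a b) u<ₗdouble-v))
    lower (inj₂ (a₂ , b₂ , c , d , refl , n≡ , lt))
      with bracket-injective {a₂} {b₂} {y₁} {y₂} (trans (sym n≡) (sym (raise-bracket ry)))
    ... | refl , refl with raise-R c d
    ...   | r@(raised x₁ x₂ _ kx) =
      conclude (sym (raise-bracket r))
        (≤ₗ-<ₗ-trans kx (<ₗ-≤ₗ-trans (⊞-monoˡ-<ₗ v lt)
          (≤ₗ-trans (⊞-monoˡ-≤ₗ v ky) (≤ₗ-reflexive (⊞-double (key a b) v)))))

-- Polynomials and leading forms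

tpow-≤ : ∀ k p {m} → k ≤ m → (tpow k · p) m ≡ p (m ∸ k)
tpow-≤ k p {m} le with k ≤ᵇ m | ≤⇒≤ᵇ le
... | true | _ = refl

tpow-< : ∀ k p {m} → m < k → (tpow k · p) m ≡ false
tpow-< k p {m} lt with k ≤ᵇ m in eq
... | false = refl
... | true  = ⊥-elim (<⇒≱ lt (≤ᵇ⇒≤ k m (subst T (sym eq) _)))

tpow-+ : ∀ k p m → (tpow k · p) (m + k) ≡ p m
tpow-+ k p m = trans (tpow-≤ k p (m≤n+m k m)) (cong p (m+n∸n≡m m k))

tpow-true : ∀ k p m → (tpow k · p) m ≡ true → Σ ℕ λ m₀ → (m ≡ m₀ + k) × (p m₀ ≡ true)
tpow-true k p m eq with k ≤? m
... | yes le = m ∸ k , sym (m∸n+n≡m le) , trans (sym (tpow-≤ k p le)) eq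
... | no  nle with () ← trans (sym (tpow-< k p (≰⇒> nle))) eq

tpow-cong : ∀ k {p q} → p ≈ q → (tpow k · p) ≈ (tpow k · q)
tpow-cong k eq m with k ≤ᵇ m
... | true  = eq (m ∸ k)
... | false = refl

tpow-⊕ : ∀ k p q → (tpow k · (p ⊕ q)) ≈ ((tpow k · p) ⊕ (tpow k · q))
tpow-⊕ k p q m with k ≤ᵇ m
... | true  = refl
... | false = refl

tpow-tpow : ∀ a b p → (tpow a · (tpow b · p)) ≈ (tpow (a + b) · p)
tpow-tpow a b p m with a + b ≤? m | a ≤? m
... | yes ab≤m | _ = begin
  (tpow a · (tpow b · p)) m ≡⟨ tpow-≤ a (tpow b · p) (≤-trans (m≤m+n a b) ab≤m) ⟩
  (tpow b · p) (m ∸ a)      ≡⟨ tpow-≤ b p (subst (_≤ m ∸ a) (m+n∸m≡n a b) (∸-monoˡ-≤ a ab≤m)) ⟩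
  p (m ∸ a ∸ b)             ≡⟨ cong p (∸-+-assoc m a b) ⟩
  p (m ∸ (a + b))           ≡⟨ tpow-≤ (a + b) p ab≤m ⟨
  (tpow (a + b) · p) m      ∎
  where open ≡-Reasoning
... | no ab≰m | yes a≤m = trans (tpow-≤ a (tpow b · p) a≤m) (trans (tpow-< b p m∸a<b) (sym (tpow-< (a + b) p (≰⇒> ab≰m))))
  where
  m∸a<b : m ∸ a < b
  m∸a<b = +-cancelˡ-< a (m ∸ a) b (subst (_< a + b) (sym (m+[n∸m]≡n a≤m)) (≰⇒> ab≰m))
... | no ab≰m | no a≰m = trans (tpow-< a (tpow b · p) (≰⇒> a≰m)) (sym (tpow-< (a + b) p (≰⇒> ab≰m)))

leadForm-≈ : ∀ {n p q} → p ≈ q → LeadForm n q → LeadForm n p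
leadForm-≈ {n} eq (lead , rest) = trans (eq n) lead , λ m m≢n pm → rest m m≢n (trans (sym (eq m)) pm)

leadForm-support : ∀ {n p m} → LeadForm n p → p m ≡ true → m ≡ n ⊎ Precedes m n
leadForm-support {n} {m = m} (_ , rest) pm with m ≟ n
... | yes m≡n = inj₁ m≡n
... | no  m≢n = inj₂ (rest m m≢n pm)

leadForm-step : ∀ {R} → Stride R → ∀ {n P Q} → Odd n → n < 8 * R → LeadForm n P → LeadForm (n + 2 * R) Q →
  LeadForm (n + 8 * R) ((tpow (8 * R) · P) ⊕ (tpow (2 * R) · Q))
leadForm-step {R} S {n} {P} {Q} odd n< lfP lfQ = lead , rest
  where
  8R≡6R+2R : n + 8 * R ≡ n + 6 * R + 2 * R
  8R≡6R+2R = regroup n R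
    where
    regroup : ∀ n R → n + 8 * R ≡ n + 6 * R + 2 * R
    regroup = solve-∀
  -- Otherwise t^(n+6R) would precede t^(n+2R), so t^(n+8R) would precede itself.
  Q-at-6R : Q (n + 6 * R) ≡ false
  Q-at-6R with Q (n + 6 * R) in eq
  ... | false = refl
  ... | true  = ⊥-elim (precedes-irrefl (subst (λ m → Precedes m (n + 8 * R)) (sym 8R≡6R+2R)
                  (precedes-+2* S odd n< (leadForm-support lfQ eq))))
  lead : ((tpow (8 * R) · P) ⊕ (tpow (2 * R) · Q)) (n + 8 * R) ≡ true
  lead = cong₂ _xor_ (trans (tpow-+ (8 * R) P n) (proj₁ lfP))
                     (trans (cong (tpow (2 * R) · Q) 8R≡6R+2R) (trans (tpow-+ (2 * R) Q (n + 6 * R)) Q-at-6R))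
  rest : ∀ m → m ≢ n + 8 * R → ((tpow (8 * R) · P) ⊕ (tpow (2 * R) · Q)) m ≡ true → Precedes m (n + 8 * R)
  rest m m≢ coeff with (tpow (8 * R) · P) m in eqP
  ... | true with tpow-true (8 * R) P m eqP
  ...   | m₀ , refl , Pm₀ with leadForm-support lfP Pm₀
  ...     | inj₁ refl = ⊥-elim (m≢ refl)
  ...     | inj₂ prec = precedes-+8* S n< prec
  rest m m≢ coeff | false with tpow-true (2 * R) Q m coeff
  ...   | m₀ , refl , Qm₀ = precedes-+2* S odd n< (leadForm-support lfQ Qm₀)

Recurrence : (ℕ → Coeffs) → ℕ → Set
Recurrence A R = ∀ n → Odd n → A (n + 8 * R) ≈ ((tpow (8 * R) · A n) ⊕ (tpow (2 * R) · A (n + 2 * R)))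

odd-+2* : ∀ {n} x → Odd n → Odd (n + 2 * x)
odd-+2* {n} x odd = trans (cong (λ y → (n + y) % 2) (*-comm 2 x)) (trans ([m+kn]%n≡m%n n x 2) odd)

odd-+2*⁻¹ : ∀ {n} x → Odd (n + 2 * x) → Odd n
odd-+2*⁻¹ {n} x odd = trans (sym ([m+kn]%n≡m%n n x 2)) (trans (cong (λ y → (n + y) % 2) (*-comm x 2)) odd)

recurrence-shifted : ∀ {A R} → Recurrence A R → ∀ {n} → Odd n → ∀ k →
  (tpow k · A (n + 8 * R)) ≈ ((tpow (k + 8 * R) · A n) ⊕ (tpow (k + 2 * R) · A (n + 2 * R)))
recurrence-shifted {A} {R} rec {n} odd k m = begin
  (tpow k · A (n + 8 * R)) m
    ≡⟨ tpow-cong k (rec n odd) m ⟩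
  (tpow k · ((tpow (8 * R) · A n) ⊕ (tpow (2 * R) · A (n + 2 * R)))) m
    ≡⟨ tpow-⊕ k (tpow (8 * R) · A n) (tpow (2 * R) · A (n + 2 * R)) m ⟩
  (tpow k · (tpow (8 * R) · A n)) m xor (tpow k · (tpow (2 * R) · A (n + 2 * R))) m
    ≡⟨ cong₂ _xor_ (tpow-tpow k (8 * R) (A n) m) (tpow-tpow k (2 * R) (A (n + 2 * R)) m) ⟩
  (tpow (k + 8 * R) · A n) m xor (tpow (k + 2 * R) · A (n + 2 * R)) m
    ∎
  where open ≡-Reasoning

-- Over Z/2 the two cross terms t^(10R) A_{n+2R} cancel.
recurrence-double : ∀ {A R} → Recurrence A R → Recurrence A (2 * R)
recurrence-double {A} {R} rec n odd m = begin
  A (n + 8 * (2 * R)) m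
    ≡⟨ cong (λ i → A i m) (regroup₁ n R) ⟩
  A (n + 8 * R + 8 * R) m
    ≡⟨ rec (n + 8 * R) (subst (λ i → Odd (n + i)) (sym (8*≡2*4* R)) (odd-+2* {n} (4 * R) odd)) m ⟩
  (tpow (8 * R) · A (n + 8 * R)) m xor (tpow (2 * R) · A (n + 8 * R + 2 * R)) m
    ≡⟨ cong (λ i → (tpow (8 * R) · A (n + 8 * R)) m xor (tpow (2 * R) · A i) m) (regroup₂ n R) ⟩
  (tpow (8 * R) · A (n + 8 * R)) m xor (tpow (2 * R) · A (n + 2 * R + 8 * R)) m
    ≡⟨ cong₂ _xor_ (recurrence-shifted {A} {R} rec {n} odd (8 * R) m)
                   (recurrence-shifted {A} {R} rec {n + 2 * R} (odd-+2* {n} R odd) (2 * R) m) ⟩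
  (X (8 * R + 8 * R) xor Y (8 * R + 2 * R)) xor (Y (2 * R + 8 * R) xor Z (2 * R + 2 * R))
    ≡⟨ cong (λ i → (X (8 * R + 8 * R) xor Y i) xor (Y (2 * R + 8 * R) xor Z (2 * R + 2 * R))) (+-comm (8 * R) (2 * R)) ⟩
  (X (8 * R + 8 * R) xor Y (2 * R + 8 * R)) xor (Y (2 * R + 8 * R) xor Z (2 * R + 2 * R))
    ≡⟨ xor-cancel (X (8 * R + 8 * R)) (Y (2 * R + 8 * R)) (Z (2 * R + 2 * R)) ⟩
  X (8 * R + 8 * R) xor Z (2 * R + 2 * R)
    ≡⟨ cong₂ _xor_ (cong X (regroup₃ R)) (cong₂ (λ k i → (tpow k · A i) m) (regroup₄ R) (regroup₅ n R)) ⟩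
  (tpow (8 * (2 * R)) · A n) m xor (tpow (2 * (2 * R)) · A (n + 2 * (2 * R))) m
    ∎
  where
  open ≡-Reasoning
  X Y Z : ℕ → Bool
  X k = (tpow k · A n) m
  Y k = (tpow k · A (n + 2 * R)) m
  Z k = (tpow k · A (n + 2 * R + 2 * R)) m
  regroup₁ : ∀ n R → n + 8 * (2 * R) ≡ n + 8 * R + 8 * R
  regroup₁ = solve-∀
  regroup₂ : ∀ n R → n + 8 * R + 2 * R ≡ n + 2 * R + 8 * R
  regroup₂ = solve-∀
  regroup₃ : ∀ R → 8 * R + 8 * R ≡ 8 * (2 * R)
  regroup₃ = solve-∀
  regroup₄ : ∀ R → 2 * R + 2 * R ≡ 2 * (2 * R)
  regroup₄ = solve-∀
  regroup₅ : ∀ n R → n + 2 * R + 2 * R ≡ n + 2 * (2 * R)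
  regroup₅ = solve-∀
  xor-cancel : ∀ x y z → (x xor y) xor (y xor z) ≡ x xor z
  xor-cancel x y z = trans (xor-assoc x y (y xor z))
    (cong (x xor_) (trans (sym (xor-assoc y y z)) (cong (_xor z) (xor-same y))))

LeadFormBelow : (ℕ → Coeffs) → ℕ → Set
LeadFormBelow A N = ∀ n → Odd n → n < N → LeadForm n (A n)

leadForm-double : ∀ {A R} → Stride R → Recurrence A R → LeadFormBelow A (8 * R) → LeadFormBelow A (8 * (2 * R))
leadForm-double {A} {R} S rec below = <-rec (λ n → Odd n → n < 8 * (2 * R) → LeadForm n (A n)) step
  where
  step : ∀ n → (∀ {m} → m < n → Odd m → m < 8 * (2 * R) → LeadForm m (A m)) →
    Odd n → n < 8 * (2 * R) → LeadForm n (A n)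
  step n ih odd n< with n <? 8 * R
  ... | yes n<8R = below n odd n<8R
  ... | no  n≮8R with n ∸ 8 * R | m∸n+n≡m (≮⇒≥ n≮8R)
  ...   | n′ | refl = leadForm-≈ (rec n′ odd′)
                        (leadForm-step S odd′ n′<8R (below n′ odd′ n′<8R)
                          (ih n′+2R<n (odd-+2* {n′} R odd′) (<-trans n′+2R<n n<)))
    where
    16*≡8*+8* : ∀ R → 8 * (2 * R) ≡ 8 * R + 8 * R
    16*≡8*+8* = solve-∀
    2*+6*≡8* : ∀ R → 2 * R + 6 * R ≡ 8 * R
    2*+6*≡8* = solve-∀
    odd′ : Odd n′
    odd′ = odd-+2*⁻¹ {n′} (4 * R) (subst (λ i → Odd (n′ + i)) (8*≡2*4* R) odd)
    n′<8R : n′ < 8 * R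
    n′<8R = +-cancelʳ-< (8 * R) n′ (8 * R) (subst (n′ + 8 * R <_) (16*≡8*+8* R) n<)
    n′+2R<n : n′ + 2 * R < n′ + 8 * R
    n′+2R<n = +-monoʳ-< n′ (subst (2 * R <_) (2*+6*≡8* R) (m<m+n (2 * R) (*-monoʳ-< 6 (Stride.0<R S))))

n<2^n : ∀ n → n < 2 ^ n
n<2^n zero    = z<s
n<2^n (suc n) = subst₂ _≤_ (+-comm (suc n) 1) (cong (2 ^ n +_) (sym (+-identityʳ (2 ^ n))))
                  (+-mono-≤ (n<2^n n) (m^n>0 2 n))

leadForm-everywhere : ∀ {A} e → Recurrence A (2 ^ e) → LeadFormBelow A (8 * 2 ^ e) →
  ∀ n → Odd n → LeadForm n (A n)
leadForm-everywhere {A} e rec below n odd = proj₂ (iterate n) n odd n<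
  where
  iterate : ∀ i → Recurrence A (2 ^ (i + e)) × LeadFormBelow A (8 * 2 ^ (i + e))
  iterate zero    = rec , below
  iterate (suc i) with iterate i
  ... | rec′ , below′ = recurrence-double {A} {2 ^ (i + e)} rec′ , leadForm-double (stride (i + e)) rec′ below′
  n< : n < 8 * 2 ^ (n + e)
  n< = <-≤-trans (n<2^n n) (≤-trans (^-monoʳ-≤ 2 (m≤m+n n e)) (m≤n*m _ 8))

-- Only the range n < 8r of the base case is needed, and A n ∈ t Z/2[t²] is never used.
theorem3p3 : (k : ℕ) → (A : ℕ → Coeffs) →
    (∀ n → Odd n → InTZ2T2 (A n)) →
    (∀ n → Odd n →
      A (n + 8 * 2 ^ k) ≈ ((tpow (8 * 2 ^ k) · A n) ⊕ (tpow (2 * 2 ^ k) · A (n + 2 * 2 ^ k)))) →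
    (∀ n → Odd n → n < 8 * (2 ^ k * 2 ^ k) → LeadForm n (A n)) →
    ∀ n → Odd n → LeadForm n (A n)
theorem3p3 k A _ rec base = leadForm-everywhere k rec
  (λ n odd n< → base n odd (<-≤-trans n< (*-monoʳ-≤ 8 (m≤m*n (2 ^ k) (2 ^ k) {{m^n≢0 2 k}}))))
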